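{- Let $d>0$ be an integer, let $N\geq d$ be an integer, and let $c\geq 0$ and $m>0$ be integers. Then $$\operatorname{div}(n,d)=\operatorname{div}(c\cdot n,m)\quad\text{and}\quad \operatorname{rem}(n,d)=\operatorname{div}(\operatorname{rem}(c\cdot n,m)\cdot d,\,m)$$ hold for all integers $n\in[0,N]$ if and only if $$\frac1d\leq \frac cm<\left(1+\frac1N\right)\frac1d.$$
   Context: For a non-negative real $x$ and a positive real $y$, define $\operatorname{div}(x,y)=\lfloor x/y\rfloor$ and $\operatorname{rem}(x,y)=x-\lfloor x/y\rfloor\cdot y$, where $\lfloor\cdot\rfloor$ is the floor function. -}

module Defs where

open import Data.Nat using (ℕ; NonZero)
import Data.Nat.DivMod as ND
open import Data.Integer using (+_)
open import Data.Rational using (ℚ)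
import Data.Rational as Q

div : ℕ → (y : ℕ) → .{{_ : NonZero y}} → ℕ
div x y = x ND./ y

rem : ℕ → (y : ℕ) → .{{_ : NonZero y}} → ℕ
rem x y = x ND.% y

frac : ℕ → (b : ℕ) → .{{_ : NonZero b}} → ℚ
frac a b = (+ a) Q./ b

module Submission where

-- Let q and r be the quotient and remainder of c n by m, and s = div (r d) m, which is < d.
-- Then div (c d n) m = q d + s, so both identities hold at n exactly when q d + s is the
-- division of n by d, i.e. when div (c d n) m = n, i.e. when n m ≤ c d n < (n + 1) m.
-- The lower bound for all n is its case n = 1, m ≤ c d; the upper bound is tightest at
-- n = N because (n + 1) / n decreases. Clearing denominators, m ≤ c d and c d N < (N + 1) m
-- are the two rational inequalities.

open import Defs
open import Data.Nat using (ℕ; NonZero; zero; suc; _+_; _∸_; _*_; _≤_; _<_; _/_; _%_; >-nonZero⁻¹)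
open import Data.Nat.Properties
open import Data.Nat.DivMod
open import Data.Nat.Divisibility using (n∣m*n)
open import Data.Nat.Tactic.RingSolver using (solve-∀)
open import Algebra.Properties.CommutativeSemigroup *-commutativeSemigroup
  using (xy∙z≈xz∙y; x∙yz≈xz∙y)
open import Data.Product using (_×_; _,_; proj₁; proj₂)
open import Data.Product.Function.NonDependent.Propositional using (_×-⇔_)
open import Data.Integer as ℤ using (+_; +≤+; +<+)
import Data.Integer.Properties as ℤ
import Data.Integer.Tactic.RingSolver as ℤ-Solver
import Data.Rational as Q
import Data.Rational.Properties as Q
open import Data.Rational.Unnormalised as U using (*≡*; *≤*; *<*)
import Data.Rational.Unnormalised.Properties as U
open import Function.Bundles using (_⇔_; mk⇔; Equivalence)
import Function.Properties.Equivalence as ⇔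
open import Function.Related.Propositional using (module EquationalReasoning)
open import Relation.Binary.PropositionalEquality
  using (_≡_; refl; sym; trans; cong; cong₂; subst; subst₂; module ≡-Reasoning)

open Equivalence using (to; from)

[m*n+o]/n≡m : ∀ m {n o} .{{_ : NonZero n}} → o < n → (m * n + o) / n ≡ m
[m*n+o]/n≡m m {n} {o} o<n = begin
  (m * n + o) / n    ≡⟨ +-distrib-/-∣ˡ o (n∣m*n m) ⟩
  m * n / n + o / n  ≡⟨ cong₂ _+_ (m*n/n≡m m n) (m<n⇒m/n≡0 o<n) ⟩
  m + 0              ≡⟨ +-identityʳ m ⟩
  m                  ∎
  where open ≡-Reasoning

[m*n+o]%n≡o : ∀ m {n o} .{{_ : NonZero n}} → o < n → (m * n + o) % n ≡ o
[m*n+o]%n≡o m {n} {o} o<n = trans (%-remove-+ˡ o (n∣m*n m)) (m<n⇒m%n≡m o<n)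

m/n≡q×m%n≡r⇔q*n+r≡m : ∀ {m n q r} .{{_ : NonZero n}} → r < n →
                       (m / n ≡ q × m % n ≡ r) ⇔ q * n + r ≡ m
m/n≡q×m%n≡r⇔q*n+r≡m {m} {n} {q} r<n = mk⇔
  (λ { (refl , refl) → trans (+-comm (m / n * n) (m % n)) (sym (m≡m%n+[m/n]*n m n)) })
  (λ { refl → [m*n+o]/n≡m q r<n , [m*n+o]%n≡o q r<n })

m<[1+m/n]*n : ∀ m n .{{_ : NonZero n}} → m < suc (m / n) * n
m<[1+m/n]*n m n = begin-strict
  m                  ≡⟨ m≡m%n+[m/n]*n m n ⟩
  m % n + m / n * n  <⟨ +-monoˡ-< (m / n * n) (m%n<n m n) ⟩
  n + m / n * n      ∎
  where open ≤-Reasoning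

m/n≡q⇔q*n≤m<[1+q]*n : ∀ {m n q} .{{_ : NonZero n}} → m / n ≡ q ⇔ (q * n ≤ m × m < suc q * n)
m/n≡q⇔q*n≤m<[1+q]*n {m} {n} {q} = mk⇔
  (λ { refl → m/n*n≤m m n , m<[1+m/n]*n m n })
  (λ (q*n≤m , m<[1+q]*n) → begin
    m / n                     ≡⟨ /-congˡ (m+[n∸m]≡n q*n≤m) ⟨
    (q * n + (m ∸ q * n)) / n ≡⟨ [m*n+o]/n≡m q (m∸q*n<n m<[1+q]*n) ⟩
    q                         ∎)
  where
  open ≡-Reasoning
  m∸q*n<n : m < suc q * n → m ∸ q * n < n
  m∸q*n<n m<[1+q]*n = m<n+o⇒m∸n<o m (q * n) (subst (m <_) (+-comm n (q * n)) m<[1+q]*n)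

m*n/o≡m/o*n+m%o*n/o : ∀ m n o .{{_ : NonZero o}} → m * n / o ≡ m / o * n + m % o * n / o
m*n/o≡m/o*n+m%o*n/o m n o = begin
  m * n / o                          ≡⟨ /-congˡ (cong (_* n) (m≡m%n+[m/n]*n m o)) ⟩
  (m % o + m / o * o) * n / o        ≡⟨ /-congˡ (regroup (m % o) (m / o) o n) ⟩
  (m / o * n * o + m % o * n) / o    ≡⟨ +-distrib-/-∣ˡ (m % o * n) (n∣m*n (m / o * n)) ⟩
  m / o * n * o / o + m % o * n / o  ≡⟨ cong (_+ m % o * n / o) (m*n/n≡m (m / o * n) o) ⟩
  m / o * n + m % o * n / o          ∎
  where
  open ≡-Reasoning
  regroup : ∀ r q o n → (r + q * o) * n ≡ q * n * o + r * n
  regroup = solve-∀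

m%o*n/o<n : ∀ m n o .{{_ : NonZero n}} .{{_ : NonZero o}} → m % o * n / o < n
m%o*n/o<n m n o = m<n*o⇒m/o<n (begin-strict
  m % o * n  <⟨ *-monoˡ-< n (m%n<n m o) ⟩
  o * n      ≡⟨ *-comm o n ⟩
  n * o      ∎)
  where open ≤-Reasoning

∀≤-cong : ∀ {N} {P R : ℕ → Set} → (∀ n → P n ⇔ R n) →
          (∀ n → n ≤ N → P n) ⇔ (∀ n → n ≤ N → R n)
∀≤-cong P⇔R = mk⇔ (λ h n n≤N → to (P⇔R n) (h n n≤N)) (λ h n n≤N → from (P⇔R n) (h n n≤N))

ComputesDivRem : (c m d : ℕ) .{{_ : NonZero m}} .{{_ : NonZero d}} → ℕ → Set
ComputesDivRem c m d n = (div n d ≡ div (c * n) m) × (rem n d ≡ div (rem (c * n) m * d) m)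

computesDivRem⇔c*d*n/m≡n : ∀ c m d .{{_ : NonZero m}} .{{_ : NonZero d}} n →
                           ComputesDivRem c m d n ⇔ c * d * n / m ≡ n
computesDivRem⇔c*d*n/m≡n c m d n = begin
  (n / d ≡ c * n / m × n % d ≡ c * n % m * d / m) ∼⟨ m/n≡q×m%n≡r⇔q*n+r≡m (m%o*n/o<n (c * n) d m) ⟩
  c * n / m * d + c * n % m * d / m ≡ n           ≡⟨ cong (_≡ n) (m*n/o≡m/o*n+m%o*n/o (c * n) d m) ⟨
  c * n * d / m ≡ n                               ≡⟨ cong (λ x → x / m ≡ n) (xy∙z≈xz∙y c n d) ⟩
  c * d * n / m ≡ n                               ∎
  where open EquationalReasoning

k*N<[1+N]*m⇒k*n<[1+n]*m : ∀ {k m n N} .{{_ : NonZero m}} → n ≤ N →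
                          k * N < suc N * m → k * n < suc n * m
k*N<[1+N]*m⇒k*n<[1+n]*m {k} {m} {zero} _ _ rewrite *-zeroʳ k | +-identityʳ m = >-nonZero⁻¹ m
k*N<[1+N]*m⇒k*n<[1+n]*m {k} {m} {n@(suc _)} {N} n≤N k*N<[1+N]*m =
  *-cancelʳ-< N (k * n) (suc n * m) (begin-strict
    k * n * N          ≡⟨ xy∙z≈xz∙y k n N ⟩
    k * N * n          <⟨ *-monoˡ-< n k*N<[1+N]*m ⟩
    suc N * m * n      ≡⟨ expand N m n ⟩
    n * m * N + n * m  ≤⟨ +-monoʳ-≤ (n * m * N) (*-monoˡ-≤ m n≤N) ⟩
    n * m * N + N * m  ≡⟨ collect N m n ⟩
    suc n * m * N      ∎)
  where
  open ≤-Reasoning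
  expand : ∀ N m n → suc N * m * n ≡ n * m * N + n * m
  expand = solve-∀
  collect : ∀ N m n → n * m * N + N * m ≡ suc n * m * N
  collect = solve-∀

k*n/m≡n-upTo-N⇔m≤k×k*N<[1+N]*m : ∀ k m N .{{_ : NonZero m}} .{{_ : NonZero N}} →
  (∀ n → n ≤ N → k * n / m ≡ n) ⇔ (m ≤ k × k * N < suc N * m)
k*n/m≡n-upTo-N⇔m≤k×k*N<[1+N]*m k m N = mk⇔
  (λ fixed → m≤k (proj₁ (to bounds (fixed 1 (>-nonZero⁻¹ N)))) , proj₂ (to bounds (fixed N ≤-refl)))
  (λ (m≤k , k*N<[1+N]*m) n n≤N → from bounds
    ( subst (_≤ k * n) (*-comm m n) (*-monoˡ-≤ n m≤k)
    , k*N<[1+N]*m⇒k*n<[1+n]*m {k} n≤N k*N<[1+N]*m ))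
  where
  bounds : ∀ {n} → k * n / m ≡ n ⇔ (n * m ≤ k * n × k * n < suc n * m)
  bounds = m/n≡q⇔q*n≤m<[1+q]*n
  m≤k : 1 * m ≤ k * 1 → m ≤ k
  m≤k = subst₂ _≤_ (*-identityˡ m) (*-identityʳ k)

toℚᵘ-frac : ∀ a b .{{_ : NonZero b}} → Q.toℚᵘ (frac a b) U.≃ + a U./ b
toℚᵘ-frac a (suc b) = Q.toℚᵘ-fromℚᵘ (U.mkℚᵘ (+ a) b)

≤ᵘ-cong-≃ : ∀ {p p′ q q′} → p U.≃ p′ → q U.≃ q′ → p U.≤ q ⇔ p′ U.≤ q′
≤ᵘ-cong-≃ p≃p′ q≃q′ = mk⇔
  (λ p≤q → U.≤-respʳ-≃ q≃q′ (U.≤-respˡ-≃ p≃p′ p≤q))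
  (λ p′≤q′ → U.≤-respʳ-≃ (U.≃-sym q≃q′) (U.≤-respˡ-≃ (U.≃-sym p≃p′) p′≤q′))

<ᵘ-cong-≃ : ∀ {p p′ q q′} → p U.≃ p′ → q U.≃ q′ → p U.< q ⇔ p′ U.< q′
<ᵘ-cong-≃ p≃p′ q≃q′ = mk⇔
  (λ p<q → U.<-respʳ-≃ q≃q′ (U.<-respˡ-≃ p≃p′ p<q))
  (λ p′<q′ → U.<-respʳ-≃ (U.≃-sym q≃q′) (U.<-respˡ-≃ (U.≃-sym p≃p′) p′<q′))

+a*+b≤+c*+e⇔a*b≤c*e : ∀ a b c e → + a ℤ.* + b ℤ.≤ + c ℤ.* + e ⇔ a * b ≤ c * e
+a*+b≤+c*+e⇔a*b≤c*e a b c e rewrite sym (ℤ.pos-* a b) | sym (ℤ.pos-* c e) = mk⇔ ℤ.drop‿+≤+ +≤+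

+a*+b<+c*+e⇔a*b<c*e : ∀ a b c e → + a ℤ.* + b ℤ.< + c ℤ.* + e ⇔ a * b < c * e
+a*+b<+c*+e⇔a*b<c*e a b c e rewrite sym (ℤ.pos-* a b) | sym (ℤ.pos-* c e) = mk⇔ ℤ.drop‿+<+ +<+

frac-≤-frac⇔ : ∀ a b c e .{{_ : NonZero b}} .{{_ : NonZero e}} →
               frac a b Q.≤ frac c e ⇔ a * e ≤ c * b
frac-≤-frac⇔ a b@(suc _) c e@(suc _) = begin
  frac a b Q.≤ frac c e                    ∼⟨ mk⇔ Q.toℚᵘ-mono-≤ Q.toℚᵘ-cancel-≤ ⟩
  Q.toℚᵘ (frac a b) U.≤ Q.toℚᵘ (frac c e)  ∼⟨ ≤ᵘ-cong-≃ (toℚᵘ-frac a b) (toℚᵘ-frac c e) ⟩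
  + a U./ b U.≤ + c U./ e                  ∼⟨ mk⇔ U.drop-*≤* *≤* ⟩
  + a ℤ.* + e ℤ.≤ + c ℤ.* + b              ∼⟨ +a*+b≤+c*+e⇔a*b≤c*e a e c b ⟩
  a * e ≤ c * b                            ∎
  where open EquationalReasoning

frac-<-frac⇔ : ∀ a b c e .{{_ : NonZero b}} .{{_ : NonZero e}} →
               frac a b Q.< frac c e ⇔ a * e < c * b
frac-<-frac⇔ a b@(suc _) c e@(suc _) = begin
  frac a b Q.< frac c e                    ∼⟨ mk⇔ Q.toℚᵘ-mono-< Q.toℚᵘ-cancel-< ⟩
  Q.toℚᵘ (frac a b) U.< Q.toℚᵘ (frac c e)  ∼⟨ <ᵘ-cong-≃ (toℚᵘ-frac a b) (toℚᵘ-frac c e) ⟩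
  + a U./ b U.< + c U./ e                  ∼⟨ mk⇔ U.drop-*<* *<* ⟩
  + a ℤ.* + e ℤ.< + c ℤ.* + b              ∼⟨ +a*+b<+c*+e⇔a*b<c*e a e c b ⟩
  a * e < c * b                            ∎
  where open EquationalReasoning

[1+1/N]*1/d≡[1+N]/[N*d] : ∀ N d .{{_ : NonZero N}} .{{_ : NonZero d}} →
  (Q.1ℚ Q.+ frac 1 N) Q.* frac 1 d ≡ frac (suc N) (N * d) {{m*n≢0 N d}}
[1+1/N]*1/d≡[1+N]/[N*d] N@(suc _) d@(suc _) = Q.toℚᵘ-injective (begin
  Q.toℚᵘ ((Q.1ℚ Q.+ frac 1 N) Q.* frac 1 d)         ≈⟨ Q.toℚᵘ-homo-* (Q.1ℚ Q.+ frac 1 N) (frac 1 d) ⟩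
  Q.toℚᵘ (Q.1ℚ Q.+ frac 1 N) U.* Q.toℚᵘ (frac 1 d)  ≈⟨ U.*-cong (Q.toℚᵘ-homo-+ Q.1ℚ (frac 1 N)) U.≃-refl ⟩
  (U.1ℚᵘ U.+ Q.toℚᵘ (frac 1 N)) U.* Q.toℚᵘ (frac 1 d)
    ≈⟨ U.*-cong (U.+-cong U.≃-refl (toℚᵘ-frac 1 N)) (toℚᵘ-frac 1 d) ⟩
  (U.1ℚᵘ U.+ + 1 U./ N) U.* (+ 1 U./ d)             ≈⟨ *≡* (cross-multiplied (+ N) (+ d)) ⟩
  + suc N U./ (N * d)                               ≈⟨ toℚᵘ-frac (suc N) (N * d) ⟨
  Q.toℚᵘ (frac (suc N) (N * d))                     ∎)
  where
  open U.≃-Reasoning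
  -- Both sides are written exactly as U._+_ and U._*_ unfold, so that this is the *≡* obligation.
  cross-multiplied : ∀ n d → ((+ 1 ℤ.* n ℤ.+ + 1 ℤ.* + 1) ℤ.* + 1) ℤ.* (n ℤ.* d)
                           ≡ (+ 1 ℤ.+ n) ℤ.* ((+ 1 ℤ.* n) ℤ.* d)
  cross-multiplied = ℤ-Solver.solve-∀

theorem2 : (d N c m : ℕ) → .{{_ : NonZero d}} → .{{_ : NonZero N}} → .{{_ : NonZero m}} →
    d ≤ N →
    ((∀ (n : ℕ) → n ≤ N →
        (div n d ≡ div (c * n) m) × (rem n d ≡ div (rem (c * n) m * d) m))
     ⇔
     ((frac 1 d Q.≤ frac c m) × (frac c m Q.< (Q.1ℚ Q.+ frac 1 N) Q.* frac 1 d)))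
theorem2 d@(suc _) N@(suc _) c m _ = begin
  (∀ n → n ≤ N → ComputesDivRem c m d n)
    ∼⟨ ∀≤-cong (computesDivRem⇔c*d*n/m≡n c m d) ⟩
  (∀ n → n ≤ N → c * d * n / m ≡ n)
    ∼⟨ k*n/m≡n-upTo-N⇔m≤k×k*N<[1+N]*m (c * d) m N ⟩
  (m ≤ c * d × c * d * N < suc N * m)
    ≡⟨ cong₂ _×_ (cong (_≤ c * d) (*-identityˡ m)) (cong (_< suc N * m) (x∙yz≈xz∙y c N d)) ⟨
  (1 * m ≤ c * d × c * (N * d) < suc N * m)
    ∼⟨ ⇔.sym (frac-≤-frac⇔ 1 d c m ×-⇔ frac-<-frac⇔ c m (suc N) (N * d)) ⟩
  (frac 1 d Q.≤ frac c m × frac c m Q.< frac (suc N) (N * d))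
    ≡⟨ cong (λ r → frac 1 d Q.≤ frac c m × frac c m Q.< r) ([1+1/N]*1/d≡[1+N]/[N*d] N d) ⟨
  (frac 1 d Q.≤ frac c m × frac c m Q.< (Q.1ℚ Q.+ frac 1 N) Q.* frac 1 d)
    ∎
  where open EquationalReasoning
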